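{- Let $\mathcal{M}_1$ and $\mathcal{M}_2$ be binary matroids, let $T=E(\mathcal{M}_1)\cap E(\mathcal{M}_2)$, and suppose $\mathcal{M}_1\mid T=\mathcal{M}_2\mid T$. Let $E_1=E(\mathcal{M}_1)-T$ and $E_2=E(\mathcal{M}_2)-T$, and let $\mathcal{A}$ be the binary matroid on ground set $E_1\cup T\cup E_2$ whose set of cycles is $$\mathcal{C}(\mathcal{A})=\{C\subseteq E_1\cup T\cup E_2: C=C_1\oplus C_2\text{ for some }C_1\in\mathcal{C}(\mathcal{M}_1),\ C_2\in\mathcal{C}(\mathcal{M}_2)\}.$$ Then $\mathcal{A}$ is an amalgam of $\mathcal{M}_1$ and $\mathcal{M}_2$, i.e. $\mathcal{A}\mid(E_1\cup T)=\mathcal{M}_1$ and $\mathcal{A}\mid(E_2\cup T)=\mathcal{M}_2$.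
   Context: A cycle of a matroid is a subset of its ground set that is a disjoint union of circuits (minimal dependent sets); $\mathcal{C}(\mathcal{M})$ denotes the set of cycles of $\mathcal{M}$. For a binary matroid, $\mathcal{C}(\mathcal{M})$ (as characteristic vectors) is a vector space over $\mathrm{GF}(2)$ (the circuit space), and any subspace of $\mathrm{GF}(2)^E$ is the circuit space of a unique binary matroid on $E$; a binary matroid is determined by its cycles. $\oplus$ denotes symmetric difference. The restriction $\mathcal{M}\mid S$ is the matroid on $S$ with the rank function of $\mathcal{M}$ restricted to subsets of $S$. -}

module Defs where

open import Data.Nat using (ℕ; zero; suc; _<_)
open import Data.Bool using (Bool; true; false; _xor_)
open import Data.Fin using (Fin)
import Data.Fin as F
open import Data.Vec using (Vec; []; _∷_; zipWith; replicate)
open import Data.Fin.Subset using (Subset; _⊆_; _∪_; _∩_; _─_; _∈_; _∉_; ⊥; ⁅_⁆; ∣_∣; Nonempty)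
open import Data.Product using (Σ; ∃; ∃-syntax; _×_)
open import Data.List using (List; []; _∷_; foldr)
open import Data.List.Relation.Unary.All using (All)
open import Data.List.Relation.Unary.AllPairs using (AllPairs)
open import Relation.Nullary using (¬_)
open import Relation.Binary.PropositionalEquality using (_≡_; _≢_)
open import Function.Bundles using (_⇔_)

-- All matroids live inside a common finite universe Fin n;
-- a matroid has a ground set E ⊆ Fin n and an independence predicate
-- satisfying the usual independence axioms (I1)–(I3).
record Matroid (n : ℕ) : Set₁ where
  field
    ground   : Subset n
    Indep    : Subset n → Set
    indep⊆E  : ∀ {I} → Indep I → I ⊆ ground
    indep-⊥  : Indep ⊥
    indep-↓  : ∀ {I J} → Indep J → I ⊆ J → Indep I
    indep-aug : ∀ {I J} → Indep I → Indep J → ∣ I ∣ < ∣ J ∣ →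
                ∃[ x ] (x ∈ J × x ∉ I × Indep (I ∪ ⁅ x ⁆))

open Matroid public

module _ {n : ℕ} where

  _⊕_ : Subset n → Subset n → Subset n
  _⊕_ = zipWith _xor_

  Disjoint : Subset n → Subset n → Set
  Disjoint X Y = X ∩ Y ≡ ⊥

  Dependent : Matroid n → Subset n → Set
  Dependent M X = X ⊆ ground M × ¬ Indep M X

  Circuit : Matroid n → Subset n → Set
  Circuit M C = Dependent M C × (∀ D → D ⊆ C → Dependent M D → D ≡ C)

  Cycle : Matroid n → Subset n → Set
  Cycle M C = Σ (List (Subset n)) λ cs →
    All (Circuit M) cs × AllPairs Disjoint cs × foldr _∪_ ⊥ cs ≡ C

colSum : ∀ {n m} → (Fin n → Vec Bool m) → Subset n → Vec Bool m
colSum {zero}  {m} v []        = replicate m false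
colSum {suc n} {m} v (b ∷ J)   with b
... | true  = zipWith _xor_ (v F.zero) (colSum (λ j → v (F.suc j)) J)
... | false = colSum (λ j → v (F.suc j)) J

LinIndepGF2 : ∀ {n m} → (Fin n → Vec Bool m) → Subset n → Set
LinIndepGF2 {n} {m} v I =
  ∀ J → J ⊆ I → Nonempty J → colSum v J ≢ replicate m false

Binary : ∀ {n} → Matroid n → Set
Binary {n} M = ∃[ m ] Σ (Fin n → Vec Bool m) λ v →
  ∀ I → Indep M I ⇔ (I ⊆ ground M × LinIndepGF2 v I)

_≅_ : ∀ {n} → Matroid n → Matroid n → Set
M ≅ N = ground M ≡ ground N × (∀ I → Indep M I ⇔ Indep N I)

RestrictionIs : ∀ {n} → Matroid n → Subset n → Matroid n → Set
RestrictionIs M S N = ground N ≡ S × (∀ I → (Indep M I × I ⊆ S) ⇔ Indep N I)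

SameRestriction : ∀ {n} → Matroid n → Matroid n → Subset n → Set
SameRestriction M₁ M₂ S = ∀ I → (Indep M₁ I × I ⊆ S) ⇔ (Indep M₂ I × I ⊆ S)

-- Every cycle of ℳ₁ is a cycle of 𝒜 (take C₂ = ∅), so a subset of E(ℳ₁) independent in 𝒜 contains no
-- circuit of ℳ₁. Conversely, a circuit D ⊆ E(ℳ₁) of 𝒜 is C₁ ⊕ C₂ with C₂ ⊆ T, so C₂ is a cycle of
-- ℳ₂ ∣ T = ℳ₁ ∣ T. Cycles of ℳ₁ have zero column sum in a GF(2)-representation of ℳ₁, hence so has D,
-- and D is dependent in ℳ₁. The argument is symmetric in ℳ₁ and ℳ₂. Binarity of 𝒜 is used only to
-- make its independence decidable, so that each dependent set contains a circuit.
module Submission where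

open import Defs
open import Algebra.Bundles using (CommutativeMonoid)
open import Algebra.Structures using (IsCommutativeMonoid)
import Algebra.Properties.CommutativeSemigroup as CommutativeSemigroupProperties
open import Data.Bool using (Bool; true; false; _xor_; _≟_)
open import Data.Bool.Properties using (xor-assoc; xor-comm; xor-identityˡ; xor-identityʳ; xor-same)
open import Data.Empty using (⊥-elim)
open import Data.Fin using (Fin)
import Data.Fin as Fin
open import Data.Fin.Subset using (Subset; _⊆_; _∪_; _∩_; _─_; _∈_; _∉_; ⊥; ⋃; ∣_∣; Nonempty; Empty)
open import Data.Fin.Subset.Properties
  using (_∈?_; _⊆?_; _⊂?_; nonempty?; anySubset?; Empty-unique; ∉⊥; ⊆-refl; ⊆-trans; ⊆-antisym;
         p⊂q⇒∣p∣<∣q∣; p⊆p∪q; q⊆p∪q; p∩q⊆p; p∩q⊆q; x∈p∩q⁺; x∈p∪q⁻; p─q⊆p; x∈p∧x∉q⇒x∈p─q;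
         ∩-comm; ∩-zeroʳ; ∩-distribˡ-∪; ∪-identityˡ; ∪-identityʳ; ∪-assoc; ∪-comm)
open import Data.List using (List; []; _∷_)
open import Data.List.Relation.Unary.All using (All; []; _∷_)
import Data.List.Relation.Unary.All as All
open import Data.List.Relation.Unary.AllPairs using (AllPairs; []; _∷_)
open import Data.Nat using (ℕ; zero; suc; _<_)
open import Data.Nat.Induction using (<-wellFounded)
open import Data.Product using (∃-syntax; _×_; _,_; proj₁; proj₂; map₂; uncurry)
open import Data.Sum using ([_,_]′)
open import Data.Vec using (Vec; []; _∷_; tail; here; there)
open import Data.Vec.Properties using (zipWith-assoc; zipWith-comm; zipWith-identityˡ; zipWith-identityʳ; ≡-dec)
open import Function.Base using (_∘_; case_of_)
open import Function.Bundles using (_⇔_; mk⇔; Equivalence)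
open import Function.Construct.Symmetry using (⇔-sym)
open import Induction.WellFounded using (Acc; acc)
open import Level using (0ℓ)
open import Relation.Nullary using (¬_; yes; no)
open import Relation.Nullary.Decidable using (_×-dec_; ¬?; decidable-stable)
import Relation.Nullary.Decidable as Dec
open import Relation.Unary using (Decidable)
open import Relation.Binary.PropositionalEquality
  using (_≡_; refl; sym; trans; cong; cong₂; subst; subst₂; module ≡-Reasoning)
open import Relation.Binary.PropositionalEquality.Algebra using (isMagma)

open Equivalence
open ≡-Reasoning

-- Subset m is Vec Bool m, so _⊕_ is also addition in GF(2)^m, with zero ⊥.
⊕-isCommutativeMonoid : ∀ {m} → IsCommutativeMonoid _≡_ (_⊕_ {m}) ⊥
⊕-isCommutativeMonoid = record
  { isMonoid = record
    { isSemigroup = record { isMagma = isMagma _⊕_ ; assoc = zipWith-assoc xor-assoc }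
    ; identity    = zipWith-identityˡ xor-identityˡ , zipWith-identityʳ xor-identityʳ
    }
  ; comm = zipWith-comm xor-comm
  }

⊕-commutativeMonoid : ℕ → CommutativeMonoid 0ℓ 0ℓ
⊕-commutativeMonoid m = record { isCommutativeMonoid = ⊕-isCommutativeMonoid {m} }

module _ {m : ℕ} where
  open CommutativeMonoid (⊕-commutativeMonoid m) public
    using () renaming (identityˡ to ⊕-identityˡ; identityʳ to ⊕-identityʳ; comm to ⊕-comm)
  open CommutativeSemigroupProperties (CommutativeMonoid.commutativeSemigroup (⊕-commutativeMonoid m))
    public using () renaming (interchange to ⊕-interchange)

⊕-self : ∀ {m} (x : Vec Bool m) → x ⊕ x ≡ ⊥
⊕-self []      = refl
⊕-self (b ∷ x) = cong₂ _∷_ (xor-same b) (⊕-self x)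

x∉p∧x∈q⇒x∈p⊕q : ∀ {n} {x : Fin n} {p q : Subset n} → x ∉ p → x ∈ q → x ∈ p ⊕ q
x∉p∧x∈q⇒x∈p⊕q {p = true  ∷ p} {true ∷ q} x∉p here      = ⊥-elim (x∉p here)
x∉p∧x∈q⇒x∈p⊕q {p = false ∷ p} {true ∷ q} x∉p here      = here
x∉p∧x∈q⇒x∈p⊕q {p = _     ∷ p} {_ ∷ q}    x∉p (there x∈q) =
  there (x∉p∧x∈q⇒x∈p⊕q (x∉p ∘ there) x∈q)

p⊆r∧p⊕q⊆r⇒q⊆r : ∀ {n} {p q r : Subset n} → p ⊆ r → p ⊕ q ⊆ r → q ⊆ r
p⊆r∧p⊕q⊆r⇒q⊆r {p = p} p⊆r p⊕q⊆r {x} x∈q with x ∈? p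
... | yes x∈p = p⊆r x∈p
... | no  x∉p = p⊕q⊆r (x∉p∧x∈q⇒x∈p⊕q x∉p x∈q)

disjoint⇒∪≡⊕ : ∀ {n} (p q : Subset n) → Disjoint p q → p ∪ q ≡ p ⊕ q
disjoint⇒∪≡⊕ []          []          _  = refl
disjoint⇒∪≡⊕ (true ∷ p)  (true ∷ q)  ()
disjoint⇒∪≡⊕ (true ∷ p)  (false ∷ q) pq = cong (true ∷_) (disjoint⇒∪≡⊕ p q (cong tail pq))
disjoint⇒∪≡⊕ (false ∷ p) (true ∷ q)  pq = cong (true ∷_) (disjoint⇒∪≡⊕ p q (cong tail pq))
disjoint⇒∪≡⊕ (false ∷ p) (false ∷ q) pq = cong (false ∷_) (disjoint⇒∪≡⊕ p q (cong tail pq))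

disjoint-⋃ : ∀ {n} (p : Subset n) cs → All (Disjoint p) cs → Disjoint p (⋃ cs)
disjoint-⋃ p []       []       = ∩-zeroʳ p
disjoint-⋃ p (c ∷ cs) (d ∷ ds) = begin
  p ∩ (c ∪ ⋃ cs)        ≡⟨ ∩-distribˡ-∪ p c (⋃ cs) ⟩
  p ∩ c ∪ p ∩ ⋃ cs      ≡⟨ cong₂ _∪_ d (disjoint-⋃ p cs ds) ⟩
  ⊥ ∪ ⊥                 ≡⟨ ∪-identityˡ ⊥ ⟩
  ⊥                     ∎

⋃-⊆ : ∀ {n} {r : Subset n} cs → All (_⊆ r) cs → ⋃ cs ⊆ r
⋃-⊆ []       []              x∈⋃ = ⊥-elim (∉⊥ x∈⋃)
⋃-⊆ (c ∷ cs) (c⊆r ∷ cs⊆r) x∈⋃ = [ c⊆r , ⋃-⊆ cs cs⊆r ]′ (x∈p∪q⁻ c (⋃ cs) x∈⋃)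

p─q∪q≡p : ∀ {n} {p q : Subset n} → q ⊆ p → (p ─ q) ∪ q ≡ p
p─q∪q≡p {p = p} {q} q⊆p = ⊆-antisym
  (λ x∈ → [ p─q⊆p p q , q⊆p ]′ (x∈p∪q⁻ (p ─ q) q x∈))
  (λ {x} x∈p → case x ∈? q of λ where
     (yes x∈q) → q⊆p∪q (p ─ q) q x∈q
     (no  x∉q) → p⊆p∪q q (x∈p∧x∉q⇒x∈p─q x∈p x∉q))

infixr 25 _·_

_·_ : ∀ {m} → Bool → Vec Bool m → Vec Bool m
true  · w = w
false · w = ⊥

·-distribʳ-xor : ∀ {m} b c (w : Vec Bool m) → (b xor c) · w ≡ b · w ⊕ c · w
·-distribʳ-xor true  true  w = sym (⊕-self w)
·-distribʳ-xor true  false w = sym (⊕-identityʳ w)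
·-distribʳ-xor false c     w = sym (⊕-identityˡ (c · w))

colSum-∷ : ∀ {n m} (v : Fin (suc n) → Vec Bool m) b (J : Subset n) →
           colSum v (b ∷ J) ≡ b · v Fin.zero ⊕ colSum (v ∘ Fin.suc) J
colSum-∷ v true  J = refl
colSum-∷ v false J = sym (⊕-identityˡ _)

colSum-⊥ : ∀ {n m} (v : Fin n → Vec Bool m) → colSum v ⊥ ≡ ⊥
colSum-⊥ {zero}  v = refl
colSum-⊥ {suc n} v = colSum-⊥ (v ∘ Fin.suc)

colSum-⊕ : ∀ {n m} (v : Fin n → Vec Bool m) (p q : Subset n) →
           colSum v (p ⊕ q) ≡ colSum v p ⊕ colSum v q
colSum-⊕ {zero}  v []      []      = sym (⊕-self ⊥)
colSum-⊕ {suc n} v (b ∷ p) (c ∷ q) = begin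
  colSum v ((b xor c) ∷ p ⊕ q)                   ≡⟨ colSum-∷ v (b xor c) (p ⊕ q) ⟩
  (b xor c) · v₀ ⊕ colSum v′ (p ⊕ q)             ≡⟨ cong₂ _⊕_ (·-distribʳ-xor b c v₀) (colSum-⊕ v′ p q) ⟩
  (b · v₀ ⊕ c · v₀) ⊕ (colSum v′ p ⊕ colSum v′ q) ≡⟨ ⊕-interchange (b · v₀) (c · v₀) _ _ ⟩
  (b · v₀ ⊕ colSum v′ p) ⊕ (c · v₀ ⊕ colSum v′ q) ≡⟨ sym (cong₂ _⊕_ (colSum-∷ v b p) (colSum-∷ v c q)) ⟩
  colSum v (b ∷ p) ⊕ colSum v (c ∷ q)             ∎
  where
  v₀ = v Fin.zero
  v′ = v ∘ Fin.suc

colSum-⋃≡⊥ : ∀ {n m} (v : Fin n → Vec Bool m) {cs : List (Subset n)} →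
             All (λ c → colSum v c ≡ ⊥) cs → AllPairs Disjoint cs → colSum v (⋃ cs) ≡ ⊥
colSum-⋃≡⊥ v []                [] = colSum-⊥ v
colSum-⋃≡⊥ v {c ∷ cs} (c≡⊥ ∷ cs≡⊥) (c#cs ∷ cs#) = begin
  colSum v (c ∪ ⋃ cs)          ≡⟨ cong (colSum v) (disjoint⇒∪≡⊕ c (⋃ cs) (disjoint-⋃ c cs c#cs)) ⟩
  colSum v (c ⊕ ⋃ cs)          ≡⟨ colSum-⊕ v c (⋃ cs) ⟩
  colSum v c ⊕ colSum v (⋃ cs) ≡⟨ cong₂ _⊕_ c≡⊥ (colSum-⋃≡⊥ v cs≡⊥ cs#) ⟩
  ⊥ ⊕ ⊥                        ≡⟨ ⊕-self ⊥ ⟩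
  ⊥                            ∎

module _ {n : ℕ} {P : Subset n → Set} (P? : Decidable P) where

  minimal⊆ : ∀ {X} → P X → ∃[ C ] (C ⊆ X × P C × (∀ D → D ⊆ C → P D → D ≡ C))
  minimal⊆ {X} = go X (<-wellFounded _)
    where
    go : ∀ X → Acc _<_ (∣ X ∣) → P X →
         ∃[ C ] (C ⊆ X × P C × (∀ D → D ⊆ C → P D → D ≡ C))
    go X (acc smaller) pX with anySubset? (λ D → D ⊂? X ×-dec P? D)
    ... | yes (D , D⊂X , pD) =
      let C , C⊆D , pC , minC = go D (smaller (p⊂q⇒∣p∣<∣q∣ D⊂X)) pD
      in C , ⊆-trans C⊆D (proj₁ D⊂X) , pC , minC
    ... | no noneSmaller = X , ⊆-refl , pX , λ D D⊆X pD → ⊆-antisym D⊆X (λ {x} x∈X →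
      decidable-stable (x ∈? D) (λ x∉D → noneSmaller (D , (D⊆X , x , x∈X , x∉D) , pD)))

module _ {n : ℕ} (M : Matroid n) where

  dependent⇒circuit : Decidable (Indep M) → ∀ {X} → Dependent M X → ∃[ C ] (C ⊆ X × Circuit M C)
  dependent⇒circuit indep? = minimal⊆ (λ D → D ⊆? ground M ×-dec ¬? (indep? D))

  circuit-nonempty : ∀ {C} → Circuit M C → Nonempty C
  circuit-nonempty {C} ((_ , ¬indC) , _) = decidable-stable (nonempty? C) λ empty →
    ¬indC (subst (Indep M) (sym (Empty-unique empty)) (indep-⊥ M))

  circuit⇒cycle : ∀ {C} → Circuit M C → Cycle M C
  circuit⇒cycle {C} circC = C ∷ [] , circC ∷ [] , [] ∷ [] , ∪-identityʳ C

  ⊥-cycle : Cycle M ⊥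
  ⊥-cycle = [] , [] , [] , refl

  cycle⊆ground : ∀ {C} → Cycle M C → C ⊆ ground M
  cycle⊆ground (cs , circuits , _ , refl) = ⋃-⊆ cs (All.map (λ ((C⊆E , _) , _) {_} → C⊆E) circuits)

  cycle⊆indep⇒empty : ∀ {I C} → Indep M I → Cycle M C → C ⊆ I → Empty C
  cycle⊆indep⇒empty _   ([] , _ , _ , refl) _ (_ , x∈⊥) = ∉⊥ x∈⊥
  cycle⊆indep⇒empty indI (c ∷ cs , ((_ , ¬indc) , _) ∷ _ , _ , refl) C⊆I _ =
    ¬indc (indep-↓ M indI (⊆-trans (p⊆p∪q (⋃ cs)) C⊆I))

module _ {n : ℕ} (M N : Matroid n) {S : Subset n}
         (S⊆M : S ⊆ ground M) (S⊆N : S ⊆ ground N) (same : SameRestriction M N S) where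

  indep⇔ : ∀ {D} → D ⊆ S → Indep M D ⇔ Indep N D
  indep⇔ D⊆S = mk⇔ (λ indM → proj₁ (to (same _) (indM , D⊆S)))
                   (λ indN → proj₁ (from (same _) (indN , D⊆S)))

  circuit-transfer : ∀ {C} → C ⊆ S → Circuit N C → Circuit M C
  circuit-transfer C⊆S ((_ , ¬indN) , minN) =
    (⊆-trans C⊆S S⊆M , ¬indN ∘ to (indep⇔ C⊆S)) ,
    λ D D⊆C (_ , ¬indM) → let D⊆S = ⊆-trans D⊆C C⊆S in
      minN D D⊆C (⊆-trans D⊆S S⊆N , ¬indM ∘ from (indep⇔ D⊆S))

  circuits-transfer : ∀ cs → ⋃ cs ⊆ S → All (Circuit N) cs → All (Circuit M) cs
  circuits-transfer []       _    []             = []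
  circuits-transfer (c ∷ cs) cs⊆S (circ ∷ circs) =
    circuit-transfer (⊆-trans (p⊆p∪q (⋃ cs)) cs⊆S) circ ∷
    circuits-transfer cs (⊆-trans (q⊆p∪q c (⋃ cs)) cs⊆S) circs

  cycle-transfer : ∀ {C} → C ⊆ S → Cycle N C → Cycle M C
  cycle-transfer C⊆S (cs , circuits , disjoint , refl) =
    cs , circuits-transfer cs C⊆S circuits , disjoint , refl

Represents : ∀ {n m} → Matroid n → (Fin n → Vec Bool m) → Set
Represents M v = ∀ I → Indep M I ⇔ (I ⊆ ground M × LinIndepGF2 v I)

module _ {n m : ℕ} (v : Fin n → Vec Bool m) where

  ZeroSumSubset : Subset n → Set
  ZeroSumSubset I = ∃[ J ] (J ⊆ I × Nonempty J × colSum v J ≡ ⊥)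

  zeroSumSubset? : Decidable ZeroSumSubset
  zeroSumSubset? I =
    anySubset? λ J → J ⊆? I ×-dec nonempty? J ×-dec ≡-dec _≟_ (colSum v J) ⊥

  linIndep⇔¬zeroSumSubset : ∀ {I} → LinIndepGF2 v I ⇔ (¬ ZeroSumSubset I)
  linIndep⇔¬zeroSumSubset = mk⇔ (λ indep (J , J⊆I , ne , J≡⊥) → indep J J⊆I ne J≡⊥)
                                (λ ¬zero J J⊆I ne J≡⊥ → ¬zero (J , J⊆I , ne , J≡⊥))

  linIndep? : Decidable (LinIndepGF2 v)
  linIndep? I = Dec.map (⇔-sym linIndep⇔¬zeroSumSubset) (¬? (zeroSumSubset? I))

  ¬linIndep⇒zeroSumSubset : ∀ {I} → ¬ LinIndepGF2 v I → ZeroSumSubset I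
  ¬linIndep⇒zeroSumSubset {I} ¬indep =
    decidable-stable (zeroSumSubset? I) (¬indep ∘ from linIndep⇔¬zeroSumSubset)

module _ {n m : ℕ} (M : Matroid n) (v : Fin n → Vec Bool m) (rep : Represents M v) where

  represented-indep? : Decidable (Indep M)
  represented-indep? I = Dec.map (⇔-sym (rep I)) (I ⊆? ground M ×-dec linIndep? v I)

  -- A zero-sum subset J of a circuit C is dependent, so J = C by minimality.
  circuit-colSum≡⊥ : ∀ {C} → Circuit M C → colSum v C ≡ ⊥
  circuit-colSum≡⊥ {C} ((C⊆E , ¬indC) , minC) =
    let J , J⊆C , ne , J≡⊥ = ¬linIndep⇒zeroSumSubset v (¬indC ∘ from (rep C) ∘ (C⊆E ,_))
        ¬indJ = λ indJ → proj₂ (to (rep J) indJ) J ⊆-refl ne J≡⊥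
    in subst (λ K → colSum v K ≡ ⊥) (minC J J⊆C (⊆-trans J⊆C C⊆E , ¬indJ)) J≡⊥

  cycle-colSum≡⊥ : ∀ {C} → Cycle M C → colSum v C ≡ ⊥
  cycle-colSum≡⊥ (cs , circuits , disjoint , refl) =
    colSum-⋃≡⊥ v (All.map circuit-colSum≡⊥ circuits) disjoint

binary⇒indep? : ∀ {n} (M : Matroid n) → Binary M → Decidable (Indep M)
binary⇒indep? M (_ , v , rep) = represented-indep? M v rep

CycleSum : ∀ {n} → Matroid n → Matroid n → Matroid n → Set
CycleSum A M N = ∀ C → Cycle A C ⇔
  (C ⊆ ground A × ∃[ C₁ ] ∃[ C₂ ] (Cycle M C₁ × Cycle N C₂ × C ≡ C₁ ⊕ C₂))

⊕-swap : ∀ {n} {P Q : Subset n → Set} {C} →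
         ∃[ C₁ ] ∃[ C₂ ] (P C₁ × Q C₂ × C ≡ C₁ ⊕ C₂) →
         ∃[ C₁ ] ∃[ C₂ ] (Q C₁ × P C₂ × C ≡ C₁ ⊕ C₂)
⊕-swap (C₁ , C₂ , p , q , C≡) = C₂ , C₁ , q , p , trans C≡ (⊕-comm C₁ C₂)

cycleSum-comm : ∀ {n} (A M N : Matroid n) → CycleSum A M N → CycleSum A N M
cycleSum-comm A M N sum C = mk⇔ (map₂ ⊕-swap ∘ to (sum C)) (from (sum C) ∘ map₂ ⊕-swap)

module _ {n m : ℕ} (M N A : Matroid n) (v : Fin n → Vec Bool m) (rep : Represents M v)
         (indepA? : Decidable (Indep A)) (same : SameRestriction M N (ground M ∩ ground N))
         (M⊆A : ground M ⊆ ground A) (sum : CycleSum A M N) where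

  private
    indepM? = represented-indep? M v rep

  cycle⇒amalgam-cycle : ∀ {C} → Cycle M C → Cycle A C
  cycle⇒amalgam-cycle {C} cyc =
    from (sum C) (⊆-trans (cycle⊆ground M cyc) M⊆A , C , ⊥ , cyc , ⊥-cycle N , sym (⊕-identityʳ C))

  amalgam-indep⇒indep : ∀ {I} → Indep A I → I ⊆ ground M → Indep M I
  amalgam-indep⇒indep {I} indA I⊆M = decidable-stable (indepM? I) λ ¬indM →
    let D , D⊆I , circD = dependent⇒circuit M indepM? (I⊆M , ¬indM)
        cycD = cycle⇒amalgam-cycle (circuit⇒cycle M circD)
    in cycle⊆indep⇒empty A indA cycD D⊆I (circuit-nonempty M circD)

  amalgam-cycle⊆ground⇒colSum≡⊥ : ∀ {D} → Cycle A D → D ⊆ ground M → colSum v D ≡ ⊥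
  amalgam-cycle⊆ground⇒colSum≡⊥ {D} cycD D⊆M with to (sum D) cycD
  ... | _ , C₁ , C₂ , cyc₁ , cyc₂ , refl = begin
    colSum v (C₁ ⊕ C₂)        ≡⟨ colSum-⊕ v C₁ C₂ ⟩
    colSum v C₁ ⊕ colSum v C₂ ≡⟨ cong₂ _⊕_ (cycle-colSum≡⊥ M v rep cyc₁)
                                          (cycle-colSum≡⊥ M v rep cyc₂ᴹ) ⟩
    ⊥ ⊕ ⊥                     ≡⟨ ⊕-self ⊥ ⟩
    ⊥                         ∎
    where
    C₂⊆M∩N : C₂ ⊆ ground M ∩ ground N
    C₂⊆M∩N x∈C₂ =
      x∈p∩q⁺ (p⊆r∧p⊕q⊆r⇒q⊆r (cycle⊆ground M cyc₁) D⊆M x∈C₂ , cycle⊆ground N cyc₂ x∈C₂)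
    cyc₂ᴹ : Cycle M C₂
    cyc₂ᴹ = cycle-transfer M N (p∩q⊆p _ _) (p∩q⊆q _ _) same C₂⊆M∩N cyc₂

  indep⇒amalgam-indep : ∀ {I} → Indep M I → Indep A I
  indep⇒amalgam-indep {I} indM = decidable-stable (indepA? I) λ ¬indA →
    let I⊆M = indep⊆E M indM
        D , D⊆I , circD = dependent⇒circuit A indepA? (⊆-trans I⊆M M⊆A , ¬indA)
        D≡⊥ = amalgam-cycle⊆ground⇒colSum≡⊥ (circuit⇒cycle A circD) (⊆-trans D⊆I I⊆M)
    in proj₂ (to (rep I) indM) D D⊆I (circuit-nonempty A circD) D≡⊥

  amalgam-restriction : RestrictionIs A (ground M) M
  amalgam-restriction = refl , λ I →
    mk⇔ (uncurry amalgam-indep⇒indep) (λ indM → indep⇒amalgam-indep indM , indep⊆E M indM)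

lemma2 : ∀ {n : ℕ} (M₁ M₂ : Matroid n) → Binary M₁ → Binary M₂ →
  let T  = ground M₁ ∩ ground M₂
      E₁ = ground M₁ ─ T
      E₂ = ground M₂ ─ T
  in SameRestriction M₁ M₂ T →
     (A : Matroid n) → Binary A → ground A ≡ E₁ ∪ T ∪ E₂ →
     (∀ C → Cycle A C ⇔ (C ⊆ E₁ ∪ T ∪ E₂ × ∃[ C₁ ] ∃[ C₂ ] (Cycle M₁ C₁ × Cycle M₂ C₂ × C ≡ C₁ ⊕ C₂))) →
     RestrictionIs A (E₁ ∪ T) M₁ × RestrictionIs A (E₂ ∪ T) M₂
lemma2 M₁ M₂ (_ , v₁ , rep₁) (_ , v₂ , rep₂) same A binaryA A≡ cycles =
  subst (λ S → RestrictionIs A S M₁) ground₁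
    (amalgam-restriction M₁ M₂ A v₁ rep₁ indepA? same M₁⊆A sum) ,
  subst (λ S → RestrictionIs A S M₂) ground₂
    (amalgam-restriction M₂ M₁ A v₂ rep₂ indepA? same′ M₂⊆A (cycleSum-comm A M₁ M₂ sum))
  where
  T  = ground M₁ ∩ ground M₂
  E₁ = ground M₁ ─ T
  E₂ = ground M₂ ─ T
  indepA? = binary⇒indep? A binaryA
  sum : CycleSum A M₁ M₂
  sum C = subst (λ U → Cycle A C ⇔ (C ⊆ U × _)) (sym A≡) (cycles C)
  same′ : SameRestriction M₂ M₁ (ground M₂ ∩ ground M₁)
  same′ = subst (SameRestriction M₂ M₁) (∩-comm _ _) (⇔-sym ∘ same)
  ground₁ : ground M₁ ≡ E₁ ∪ T
  ground₁ = sym (p─q∪q≡p (p∩q⊆p _ _))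
  ground₂ : ground M₂ ≡ E₂ ∪ T
  ground₂ = sym (p─q∪q≡p (p∩q⊆q _ _))
  M₁⊆A : ground M₁ ⊆ ground A
  M₁⊆A = subst₂ _⊆_ (sym ground₁) (trans (∪-assoc E₁ T E₂) (sym A≡)) (p⊆p∪q E₂)
  M₂⊆A : ground M₂ ⊆ ground A
  M₂⊆A = subst₂ _⊆_ (sym (trans ground₂ (∪-comm E₂ T))) (sym A≡) (q⊆p∪q E₁ (T ∪ E₂))
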